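{- For every integer $n\ge1$, $b(C_{n,n+1})=n+1$.
   Context: The burning number of a graph $G$ is $b(G)=\min\{k : \exists v_1,\dots,v_k\in V(G) \text{ with } V(G)=\bigcup_{i=1}^k B(v_i,k-i)\}$, where $B(v,r)$ is the set of vertices at graph distance at most $r$ from $v$. The comb graph $C_{n,m}$ has vertex set $\{(i,j): 1\le i\le m,\ 1\le j\le n\}$ with edges $(1,j)\sim(1,j+1)$ for $1\le j<n$ (the spine) and $(i,j)\sim(i+1,j)$ for $1\le i<m$ (tooth $j$). -}

module Defs where

open import Data.Nat using (ℕ; zero; suc; _∸_; _≤_; _<_)
open import Data.Fin using (Fin; toℕ)
open import Data.Product using (Σ; ∃; _×_; _,_)
open import Relation.Binary.PropositionalEquality using (_≡_)
open import Relation.Nullary using (¬_)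

record Graph : Set₁ where
  field
    V   : Set
    Adj : V → V → Set

open Graph public

data Walk (G : Graph) : V G → V G → ℕ → Set where
  here : ∀ {u} → Walk G u u zero
  step : ∀ {u w v k} → Adj G u w → Walk G w v k → Walk G u v (suc k)

InBall : (G : Graph) → V G → ℕ → V G → Set
InBall G u r v = Σ ℕ λ k → k ≤ r × Walk G u v k

-- There exist v_1..v_k with V(G) = ⋃ B(v_i, k - i).
-- (Indices are 0-based: position p : Fin k corresponds to i = p+1, radius k-(p+1).)
Burns : (G : Graph) → ℕ → Set
Burns G k = Σ (Fin k → V G) λ v →
  ∀ (w : V G) → Σ (Fin k) λ p → InBall G (v p) (k ∸ suc (toℕ p)) w

BurningNumberIs : Graph → ℕ → Set
BurningNumberIs G b = Burns G b × (∀ k → k < b → ¬ Burns G k)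

-- Comb graph C_{n,m}: vertex (i,j) with 1 ≤ i ≤ m, 1 ≤ j ≤ n is represented
-- 0-based as (i-1, j-1) : Fin m × Fin n. Row i = 1 (toℕ = 0) is the spine.
data CombAdj (n m : ℕ) : Fin m × Fin n → Fin m × Fin n → Set where
  spine-r : ∀ {i j j'} → toℕ i ≡ 0 → suc (toℕ j) ≡ toℕ j' → CombAdj n m (i , j) (i , j')
  spine-l : ∀ {i j j'} → toℕ i ≡ 0 → toℕ j ≡ suc (toℕ j') → CombAdj n m (i , j) (i , j')
  tooth-d : ∀ {i i' j} → suc (toℕ i) ≡ toℕ i' → CombAdj n m (i , j) (i' , j)
  tooth-u : ∀ {i i' j} → toℕ i ≡ suc (toℕ i') → CombAdj n m (i , j) (i' , j)

Comb : ℕ → ℕ → Graph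
Comb n m = record { V = Fin m × Fin n ; Adj = CombAdj n m }

-- Upper bound: the spine root, burning with radius n, reaches every (i, j) with
-- i + j ≤ n (0-based); each remaining tooth j ≥ 1 is finished by a source at its
-- bottom vertex lit at the moment its radius has shrunk to j.
-- Lower bound: b is monotone, so it suffices to exclude n sources. The last one
-- burns only itself; each tooth has a vertex of depth ≥ n - 1 other than it, so two
-- such vertices in distinct teeth share one of the n - 1 remaining balls, of radius
-- ≤ n - 1. But every walk between teeth passes the spine, so they are at distance
-- ≥ (n - 1) + (n - 1) + 1.
module Submission where

open import Defs
open import Data.Nat using (ℕ; zero; suc; _+_; _∸_; _≤_; _<_; _≤′_; ≤′-reflexive; ≤′-step; z≤n; s≤s; _≤?_)
open import Data.Nat.Properties
open import Data.Fin as Fin using (Fin; toℕ; fromℕ; inject₁; opposite; punchOut)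
open import Data.Fin.Properties
  using (toℕ-fromℕ; toℕ-inject₁; toℕ-injective; toℕ<n; fromℕ≢inject₁; pigeonhole;
         punchOut-injective; opposite-prop; opposite-involutive)
  renaming (<⇒≢ to <⇒≢ᶠ)
open import Data.Product using (Σ; ∃; _×_; _,_; proj₁; proj₂)
open import Data.Product.Properties using (≡-dec)
open import Data.Empty using (⊥; ⊥-elim)
open import Relation.Nullary using (¬_; yes; no)
open import Relation.Binary.PropositionalEquality

module _ {G : Graph} where

  _∷ʳ_ : ∀ {u v w k} → Walk G u v k → Adj G v w → Walk G u w (suc k)
  here       ∷ʳ a = step a here
  (step b p) ∷ʳ a = step b (p ∷ʳ a)

  _++_ : ∀ {u v w k l} → Walk G u v k → Walk G v w l → Walk G u w (k + l)
  here       ++ q = q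
  (step a p) ++ q = step a (p ++ q)

  reverse : (∀ {u w} → Adj G u w → Adj G w u) →
            ∀ {u v k} → Walk G u v k → Walk G v u k
  reverse adj-sym here       = here
  reverse adj-sym (step a p) = reverse adj-sym p ∷ʳ adj-sym a

  descend : ∀ {m} (f : Fin (suc m) → V G) → (∀ i → Adj G (f (Fin.suc i)) (f (inject₁ i))) →
            ∀ d {i i'} → toℕ i + d ≡ toℕ i' → Walk G (f i') (f i) d
  descend f adj zero {i} e with toℕ-injective (trans (sym (+-identityʳ (toℕ i))) e)
  ... | refl = here
  descend f adj (suc d) {i} {Fin.zero} e = ⊥-elim (1+n≢0 (trans (sym (+-suc (toℕ i) d)) e))
  descend f adj (suc d) {i} {Fin.suc i'} e =
    step (adj i') (descend f adj d (trans (suc-injective (trans (sym (+-suc (toℕ i) d)) e))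
                                          (sym (toℕ-inject₁ i'))))

  ball-zero : ∀ {u w} → InBall G u 0 w → u ≡ w
  ball-zero (_ , z≤n , here) = refl

  burns-suc : ∀ {k} → V G → Burns G k → Burns G (suc k)
  burns-suc {k} u (v , cov) = v′ , cov′
    where
    v′ : Fin (suc k) → V G
    v′ Fin.zero    = u
    v′ (Fin.suc p) = v p
    cov′ : ∀ w → Σ (Fin (suc k)) λ p → InBall G (v′ p) (suc k ∸ suc (toℕ p)) w
    cov′ w with cov w
    ... | p , ball = Fin.suc p , ball

  burns-mono : ∀ {k l} → V G → k ≤ l → Burns G k → Burns G l
  burns-mono u k≤l = go (≤⇒≤′ k≤l)
    where
    go : ∀ {k l} → k ≤′ l → Burns G k → Burns G l
    go (≤′-reflexive refl) b = b
    go (≤′-step k≤′l)      b = burns-suc u (go k≤′l b)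

module _ {n m : ℕ} where

  row : Fin m × Fin n → ℕ
  row (i , _) = toℕ i

  tooth : Fin m × Fin n → Fin n
  tooth (_ , j) = j

  comb-sym : ∀ {u w} → CombAdj n m u w → CombAdj n m w u
  comb-sym (spine-r z e) = spine-l z (sym e)
  comb-sym (spine-l z e) = spine-r z (sym e)
  comb-sym (tooth-d e)   = tooth-u (sym e)
  comb-sym (tooth-u e)   = tooth-d (sym e)

  adj-row-≤ : ∀ {u w} → CombAdj n m u w → row u ≤ suc (row w)
  adj-row-≤ (spine-r _ _) = n≤1+n _
  adj-row-≤ (spine-l _ _) = n≤1+n _
  adj-row-≤ (tooth-d e)   = ≤-trans (n≤1+n _) (≤-trans (≤-reflexive e) (n≤1+n _))
  adj-row-≤ (tooth-u e)   = ≤-reflexive e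

  adj-across-teeth : ∀ {u w} → CombAdj n m u w → tooth u ≢ tooth w → row u ≡ 0 × row w ≡ 0
  adj-across-teeth (spine-r z _) _   = z , z
  adj-across-teeth (spine-l z _) _   = z , z
  adj-across-teeth (tooth-d _)   u≁w = ⊥-elim (u≁w refl)
  adj-across-teeth (tooth-u _)   u≁w = ⊥-elim (u≁w refl)

  walk-row-≤ : ∀ {u v k} → Walk (Comb n m) u v k → row v ≤ row u + k
  walk-row-≤ {u} here = ≤-reflexive (sym (+-identityʳ (row u)))
  walk-row-≤ {u} {v} {suc k} (step {w = w} a p) = begin
    row v             ≤⟨ walk-row-≤ p ⟩
    row w + k         ≤⟨ +-monoˡ-≤ k (adj-row-≤ (comb-sym a)) ⟩
    suc (row u) + k   ≡⟨ +-suc (row u) k ⟨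
    row u + suc k     ∎
    where open ≤-Reasoning

  walk-across-teeth : ∀ {u v k} → Walk (Comb n m) u v k → tooth u ≢ tooth v →
                      suc (row u + row v) ≤ k
  walk-across-teeth here u≁v = ⊥-elim (u≁v refl)
  walk-across-teeth {u} {v} {suc k} (step {w = w} a p) u≁v with tooth w Fin.≟ tooth v
  ... | no w≁v = s≤s (≤-trans (+-monoˡ-≤ (row v) (adj-row-≤ a)) (walk-across-teeth p w≁v))
  ... | yes w∼v with adj-across-teeth a (λ u∼w → u≁v (trans u∼w w∼v))
  ...   | u-on-spine , w-on-spine = s≤s (begin
    row u + row v   ≡⟨ cong (_+ row v) u-on-spine ⟩
    row v           ≤⟨ walk-row-≤ p ⟩
    row w + k       ≡⟨ cong (_+ k) w-on-spine ⟩
    k               ∎)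
    where open ≤-Reasoning

  ball-across-teeth : ∀ {c r x y} → InBall (Comb n m) c r x → InBall (Comb n m) c r y →
                      tooth x ≢ tooth y → suc (row x + row y) ≤ r + r
  ball-across-teeth (a , a≤r , c→x) (b , b≤r , c→y) x≁y =
    ≤-trans (walk-across-teeth (reverse comb-sym c→x ++ c→y) x≁y) (+-mono-≤ a≤r b≤r)

  deep-across-teeth-not-in-ball : ∀ {c r d x y} → r ≤ d → d ≤ row x → d ≤ row y → tooth x ≢ tooth y →
                                  InBall (Comb n m) c r x → InBall (Comb n m) c r y → ⊥
  deep-across-teeth-not-in-ball r≤d d≤x d≤y x≁y x∈B y∈B =
    n≮n _ (≤-trans (ball-across-teeth x∈B y∈B x≁y) (+-mono-≤ (≤-trans r≤d d≤x) (≤-trans r≤d d≤y)))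

up-tooth : ∀ {n m} (j : Fin n) d {i i' : Fin (suc m)} → toℕ i + d ≡ toℕ i' →
           Walk (Comb n (suc m)) (i' , j) (i , j) d
up-tooth j = descend (λ i → i , j) (λ i → tooth-u (cong suc (sym (toℕ-inject₁ i))))

along-spine : ∀ {n m} d {j j' : Fin (suc n)} → toℕ j + d ≡ toℕ j' →
              Walk (Comb (suc n) (suc m)) (Fin.zero , j') (Fin.zero , j) d
along-spine = descend (λ j → Fin.zero , j) (λ j → spine-l refl (cong suc (sym (toℕ-inject₁ j))))

walk-from-root : ∀ {n m} (x : Fin (suc m) × Fin (suc n)) →
                 Walk (Comb (suc n) (suc m)) (Fin.zero , Fin.zero) x (row x + toℕ (tooth x))
walk-from-root (i , j) = reverse comb-sym (up-tooth j (toℕ i) refl ++ along-spine (toℕ j) refl)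

walk-from-bottom : ∀ {n m} (x : Fin (suc m) × Fin n) →
                   Walk (Comb n (suc m)) (fromℕ m , tooth x) x (m ∸ row x)
walk-from-bottom {m = m} (i , j) =
  up-tooth j (m ∸ toℕ i) (trans (m+[n∸m]≡n (≤-pred (toℕ<n i))) (sym (toℕ-fromℕ m)))

comb-burn : ∀ n' → Burns (Comb (suc n') (suc (suc n'))) (suc (suc n'))
comb-burn n' = source , covered
  where
  N = suc n'
  G = Comb N (suc N)
  source : Fin (suc N) → V G
  source Fin.zero               = Fin.zero , Fin.zero
  source (Fin.suc Fin.zero)     = Fin.zero , Fin.zero   -- redundant: any vertex works
  source (Fin.suc (Fin.suc q))  = fromℕ N , Fin.suc (opposite q)
  covered : ∀ w → Σ (Fin (suc N)) λ p → InBall G (source p) (suc N ∸ suc (toℕ p)) w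
  covered (i , j) with toℕ i + toℕ j ≤? N
  ... | yes near = Fin.zero , _ , near , walk-from-root (i , j)
  covered (i , Fin.zero) | no far =
    ⊥-elim (far (subst (_≤ N) (sym (+-identityʳ (toℕ i))) (≤-pred (toℕ<n i))))
  covered (i , Fin.suc j) | no far =
    Fin.suc (Fin.suc (opposite j)) , N ∸ toℕ i , reach ,
    subst (λ t → Walk G (fromℕ N , Fin.suc t) (i , Fin.suc j) (N ∸ toℕ i))
          (sym (opposite-involutive j)) (walk-from-bottom (i , Fin.suc j))
    where
    reach : N ∸ toℕ i ≤ n' ∸ suc (toℕ (opposite j))
    reach = begin
      N ∸ toℕ i                        ≤⟨ m≤n+o⇒m∸n≤o N (toℕ i) (≤-pred (subst (N <_) (+-suc (toℕ i) (toℕ j)) (≰⇒> far))) ⟩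
      toℕ j                            ≡⟨ cong toℕ (opposite-involutive j) ⟨
      toℕ (opposite (opposite j))      ≡⟨ opposite-prop (opposite j) ⟩
      n' ∸ suc (toℕ (opposite j))      ∎
      where open ≤-Reasoning

deep-vertex-avoiding : ∀ {n d} (c : Fin (suc (suc d)) × Fin n) (j : Fin n) →
                       ∃ λ x → tooth x ≡ j × d ≤ row x × x ≢ c
deep-vertex-avoiding {d = d} c j with ≡-dec Fin._≟_ Fin._≟_ (fromℕ (suc d) , j) c
... | no bottom≢c = (fromℕ (suc d) , j) , refl , subst (d ≤_) (sym (toℕ-fromℕ (suc d))) (n≤1+n d) , bottom≢c
... | yes refl    = (inject₁ (fromℕ d) , j) , refl ,
                    ≤-reflexive (sym (trans (toℕ-inject₁ (fromℕ d)) (toℕ-fromℕ d))) ,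
                    λ e → fromℕ≢inject₁ (sym (cong proj₁ e))

comb-no-burn : ∀ n' → ¬ Burns (Comb (suc n') (suc (suc n'))) (suc n')
comb-no-burn n' (v , cov) =
  let i , j , i<j , same-index = pigeonhole (n<1+n n') (λ t → punchOut (last≢source t))
      same-source = punchOut-injective (last≢source i) (last≢source j) same-index
  in deep-across-teeth-not-in-ball (m∸n≤m n' (toℕ (source i))) (deep-row i) (deep-row j)
       (λ e → <⇒≢ᶠ i<j (trans (sym (tooth-is i)) (trans e (tooth-is j))))
       (ball i) (subst (λ p → Reached p (P j)) (sym same-source) (ball j))
  where
  G = Comb (suc n') (suc (suc n'))
  Reached : Fin (suc n') → V G → Set
  Reached p = InBall G (v p) (suc n' ∸ suc (toℕ p))
  last = fromℕ n'
  P : Fin (suc n') → V G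
  P t = proj₁ (deep-vertex-avoiding (v last) t)
  tooth-is : ∀ t → tooth (P t) ≡ t
  tooth-is t = proj₁ (proj₂ (deep-vertex-avoiding (v last) t))
  deep-row : ∀ t → n' ≤ row (P t)
  deep-row t = proj₁ (proj₂ (proj₂ (deep-vertex-avoiding (v last) t)))
  source : Fin (suc n') → Fin (suc n')
  source t = proj₁ (cov (P t))
  ball : ∀ t → Reached (source t) (P t)
  ball t = proj₂ (cov (P t))
  last-radius-zero : suc n' ∸ suc (toℕ last) ≡ 0
  last-radius-zero = trans (cong (n' ∸_) (toℕ-fromℕ n')) (n∸n≡0 n')
  last≢source : ∀ t → last ≢ source t
  last≢source t e = proj₂ (proj₂ (proj₂ (deep-vertex-avoiding (v last) t)))
    (sym (ball-zero (subst (λ r → InBall G (v last) r (P t)) last-radius-zero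
                           (subst (λ p → Reached p (P t)) (sym e) (ball t)))))

lemma3p4 : ∀ (n : ℕ) → 1 ≤ n → BurningNumberIs (Comb n (suc n)) (suc n)
lemma3p4 (suc n') _ =
  comb-burn n' ,
  λ k k≤n b → comb-no-burn n' (burns-mono (Fin.zero , Fin.zero) (≤-pred k≤n) b)
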